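{- Let $0<d<1$ and let $G$ be a graph on $n\geq 2$ vertices. If $\delta_2(G)\geq 2dn$, then $e(G)\geq d\frac{n^2}{2}$.
   Context: $\delta_2(G)$ is the minimum of $\deg(u)+\deg(v)$ over all pairs of distinct non-adjacent vertices $u,v$ of $G$; $e(G)$ is the number of edges of $G$.
   Formalization: The parameter d ranges over the rationals. -}

module Defs where

open import Data.Bool using (Bool; true; false)
open import Data.Nat using (ℕ; _+_; _*_)
open import Data.Fin using (Fin; _<_)
open import Data.Fin.Properties using (_<?_)
open import Data.List using (List; length; filterᵇ; filter; allFin; concatMap; map)
open import Data.Product using (_×_; _,_; proj₁; proj₂; Σ; ∃)
open import Relation.Binary.PropositionalEquality using (_≡_; _≢_)
open import Relation.Nullary using (¬_)
open import Data.Integer using (+_)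
open import Data.Rational using (ℚ; _/_)

record Graph (n : ℕ) : Set where
  field
    adj   : Fin n → Fin n → Bool
    sym   : ∀ u v → adj u v ≡ adj v u
    irrefl : ∀ v → adj v v ≡ false
open Graph public

deg : ∀ {n} → Graph n → Fin n → ℕ
deg G v = length (filterᵇ (adj G v) (allFin _))

allPairs : ∀ n → List (Fin n × Fin n)
allPairs n = concatMap (λ i → map (λ j → (i , j)) (allFin n)) (allFin n)

e : ∀ {n} → Graph n → ℕ
e {n} G = length (filterᵇ (λ p → adj G (proj₁ p) (proj₂ p))
                    (filter (λ p → proj₁ p <? proj₂ p) (allPairs n)))

NonAdj : ∀ {n} → Graph n → Fin n → Fin n → Set
NonAdj G u v = (u ≢ v) × (adj G u v ≡ false)

ℕ→ℚ : ℕ → ℚ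
ℕ→ℚ k = + k / 1

-- Let D u be the degree of u and c u = n − 1 − D u its number of non-neighbours. Summing
-- D u + D v ≥ 2dn over all ordered non-adjacent pairs (u , v) gives dn · Σ c u ≤ Σ c u D u.
-- Cauchy–Schwarz, (Σ D u)² ≤ n Σ D u², turns into n Σ c u D u ≤ (Σ D u)(Σ c u). As some pair
-- is non-adjacent, Σ c u > 0, hence dn² ≤ Σ D u = 2 e(G).
module Submission where

open import Defs hiding (sym)
open import Data.Bool using (Bool; true; false; _∧_)
import Data.Bool.Properties as Bool
open import Data.Fin using (Fin; zero; suc)
open import Data.Fin.Properties using (_≟_; _<?_; <-cmp)
import Data.Integer as ℤ
import Data.Integer.Properties as ℤ
open import Data.Integer.Properties using (pos-*; drop‿+≤+)
open import Data.List
  using (List; []; _∷_; _++_; length; filter; filterᵇ; tabulate; concatMap; map; allFin)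
open import Data.List.Properties using (filter-++; length-++; map-tabulate)
open import Data.Nat using (ℕ; zero; suc; pred; _+_; _*_; _≤_; _≥_; z≤n; NonZero; >-nonZero)
open import Data.Nat.Coprimality using (1-coprimeTo) renaming (sym to coprime-sym)
open import Data.Nat.Properties
  using (+-*-semiring; ≤-refl; ≤-reflexive; ≤-trans; ≤-total; m≤m+n; m≤n⇒∃[o]m+o≡n; +-comm;
         +-identityʳ; *-comm; *-assoc; *-identityˡ; *-identityʳ; *-zeroʳ; *-distribˡ-+; +-mono-≤;
         +-monoˡ-≤; +-monoʳ-≤; *-monoˡ-≤; *-monoʳ-≤; +-cancelʳ-≤; *-cancelˡ-≤; *-cancelʳ-≤;
         module ≤-Reasoning)
open import Algebra.Properties.Semiring.Sum +-*-semiring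
  using (sum; sum-syntax; ∑-distrib-+; ∑-comm; *-distribˡ-sum; *-distribʳ-sum; sum-cong-≗;
         sum-remove)
open import Data.Nat.Tactic.RingSolver using (solve-∀)
open import Data.Product using (∃₂; _×_; _,_; proj₁; proj₂)
open import Data.Rational using (ℚ; mkℚ; 0ℚ; 1ℚ; ½; toℚᵘ; _<_; *<*)
  renaming (_≤_ to _≤ℚ_; _*_ to _*ℚ_)
open import Data.Rational.Properties
  using (toℚᵘ-homo-*; toℚᵘ-mono-≤; toℚᵘ-cancel-≤; toℚᵘ-cong; normalize-coprime)
open import Data.Rational.Unnormalised as ℚᵘ using (mkℚᵘ; _≃_; *≤*)
open import Data.Rational.Unnormalised.Properties
  using (≃-refl; ≃-sym; ≃-trans; *-cong; ≤-respˡ-≃; ≤-respʳ-≃; drop-*≤*)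
open import Data.Sum using ([_,_]′)
open import Data.Vec.Functional using (Vector)
open import Function using (_∘_; id; _⇔_; mk⇔; Equivalence)
open import Relation.Binary.Definitions using (tri<; tri≈; tri>)
open import Relation.Binary.PropositionalEquality
  using (_≡_; refl; sym; trans; cong; cong₂; subst; subst₂; module ≡-Reasoning)
open import Relation.Nullary using (Dec; yes; no; does; T?; ¬?; _×-dec_)
open import Relation.Nullary.Decidable using (dec-true; dec-false; does-⇔)
open import Relation.Unary using (Decidable)

∑-const : ∀ n x → ∑[ i < n ] x ≡ n * x
∑-const zero    x = refl
∑-const (suc n) x = cong (x +_) (∑-const n x)

∑-mono-≤ : ∀ {n} {f g : Vector ℕ n} → (∀ i → f i ≤ g i) → sum f ≤ sum g
∑-mono-≤ {zero}  f≤g = z≤n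
∑-mono-≤ {suc n} f≤g = +-mono-≤ (f≤g zero) (∑-mono-≤ (λ i → f≤g (suc i)))

∑∑-*ʳ : ∀ {m n} (g : Fin m → Fin n → ℕ) x →
  (∑[ i < m ] ∑[ j < n ] g i j) * x ≡ ∑[ i < m ] ∑[ j < n ] (g i j * x)
∑∑-*ʳ {n = n} g x =
  trans (*-distribʳ-sum x (λ i → ∑[ j < n ] g i j)) (sum-cong-≗ (λ i → *-distribʳ-sum x (g i)))

≤-∑ : ∀ {n} (f : Vector ℕ n) i → f i ≤ sum f
≤-∑ {suc n} f i = subst (f i ≤_) (sym (sum-remove f)) (m≤m+n _ _)

∑∑-sym-+ : ∀ {n} (w : Fin n → Fin n → ℕ) (f : Vector ℕ n) → (∀ u v → w u v ≡ w v u) →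
  ∑[ u < n ] ∑[ v < n ] (w u v * (f u + f v)) ≡ 2 * ∑[ u < n ] (∑[ v < n ] w u v * f u)
∑∑-sym-+ {n} w f w-sym = begin
  ∑[ u < n ] ∑[ v < n ] (w u v * (f u + f v))
    ≡⟨ sum-cong-≗ (λ u → trans (sum-cong-≗ (λ v → *-distribˡ-+ (w u v) (f u) (f v)))
                                (∑-distrib-+ (λ v → w u v * f u) (λ v → w u v * f v))) ⟩
  ∑[ u < n ] (∑[ v < n ] (w u v * f u) + ∑[ v < n ] (w u v * f v))
    ≡⟨ ∑-distrib-+ (λ u → ∑[ v < n ] (w u v * f u)) (λ u → ∑[ v < n ] (w u v * f v)) ⟩
  X + ∑[ u < n ] ∑[ v < n ] (w u v * f v)
    ≡⟨ cong (X +_) (trans (∑-comm (λ u v → w u v * f v))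
                          (sum-cong-≗ (λ v → sum-cong-≗ (λ u → cong (_* f v) (w-sym u v))))) ⟩
  X + X
    ≡⟨ cong₂ _+_ X≡Y X≡Y ⟩
  Y + Y
    ≡⟨ cong (Y +_) (sym (+-identityʳ Y)) ⟩
  2 * Y ∎
  where
  open ≡-Reasoning
  X = ∑[ u < n ] ∑[ v < n ] (w u v * f u)
  Y = ∑[ u < n ] (∑[ v < n ] w u v * f u)
  X≡Y : X ≡ Y
  X≡Y = sum-cong-≗ (λ u → sym (*-distribʳ-sum (f u) (w u)))

2*m*n≤m*m+n*n : ∀ m n → 2 * (m * n) ≤ m * m + n * n
2*m*n≤m*m+n*n m n = [ ordered , swapped ]′ (≤-total m n)
  where
  ordered : ∀ {a b} → a ≤ b → 2 * (a * b) ≤ a * a + b * b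
  ordered {a} a≤b with k , refl ← m≤n⇒∃[o]m+o≡n a≤b =
    ≤-trans (m≤m+n _ (k * k)) (≤-reflexive (square-expansion a k))
    where
    square-expansion : ∀ a k → 2 * (a * (a + k)) + k * k ≡ a * a + (a + k) * (a + k)
    square-expansion = solve-∀
  swapped : n ≤ m → 2 * (m * n) ≤ m * m + n * n
  swapped n≤m = subst₂ _≤_ (cong (2 *_) (*-comm n m)) (+-comm (n * n) (m * m)) (ordered n≤m)

sum*sum : ∀ {n} (f g : Vector ℕ n) → sum f * sum g ≡ ∑[ i < n ] ∑[ j < n ] (f i * g j)
sum*sum f g = trans (*-distribʳ-sum (sum g) f) (sum-cong-≗ (λ i → *-distribˡ-sum (f i) g))

cauchy-schwarz : ∀ {n} (f : Vector ℕ n) → sum f * sum f ≤ n * ∑[ i < n ] (f i * f i)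
cauchy-schwarz {n} f = *-cancelˡ-≤ 2 (begin
  2 * (sum f * sum f)
    ≡⟨ cong (2 *_) (sum*sum f f) ⟩
  2 * ∑[ i < n ] ∑[ j < n ] (f i * f j)
    ≡⟨ *-distribˡ-sum 2 (λ i → ∑[ j < n ] (f i * f j)) ⟩
  ∑[ i < n ] (2 * ∑[ j < n ] (f i * f j))
    ≡⟨ sum-cong-≗ (λ i → *-distribˡ-sum 2 (λ j → f i * f j)) ⟩
  ∑[ i < n ] ∑[ j < n ] (2 * (f i * f j))
    ≤⟨ ∑-mono-≤ (λ i → ∑-mono-≤ (λ j → 2*m*n≤m*m+n*n (f i) (f j))) ⟩
  ∑[ i < n ] ∑[ j < n ] (sq i + sq j)
    ≡⟨ sum-cong-≗ (λ i → trans (∑-distrib-+ (λ _ → sq i) sq) (cong (_+ Q) (∑-const n (sq i)))) ⟩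
  ∑[ i < n ] (n * sq i + Q)
    ≡⟨ ∑-distrib-+ (λ i → n * sq i) (λ _ → Q) ⟩
  ∑[ i < n ] (n * sq i) + ∑[ i < n ] Q
    ≡⟨ cong₂ _+_ (sym (*-distribˡ-sum n sq)) (∑-const n Q) ⟩
  n * Q + n * Q
    ≡⟨ cong (n * Q +_) (sym (+-identityʳ (n * Q))) ⟩
  2 * (n * Q)
    ∎)
  where
  open ≤-Reasoning
  sq = λ i → f i * f i
  Q = ∑[ i < n ] sq i

complement-∑-bound : ∀ {n} (D c : Vector ℕ n) → (∀ u → c u + D u + 1 ≡ n) →
  n * ∑[ u < n ] (c u * D u) ≤ sum D * sum c
complement-∑-bound {n} D c c+D+1≡n = +-cancelʳ-≤ (m * m + n * m) (n * T) (m * C) (begin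
  n * T + (m * m + n * m)   ≤⟨ +-monoʳ-≤ (n * T) (+-monoˡ-≤ (n * m) (cauchy-schwarz D)) ⟩
  n * T + (n * S + n * m)   ≡⟨ regroup₁ n T S m ⟩
  n * (T + S + m)           ≡⟨ cong (n *_) ∑[c+D+1]*D ⟩
  n * (n * m)               ≡⟨ regroup₂ n m ⟩
  m * (n * n)               ≡⟨ cong (m *_) (sym ∑[c+D+1]) ⟩
  m * (C + m + n)           ≡⟨ regroup₃ m C n ⟩
  m * C + (m * m + n * m)   ∎)
  where
  open ≤-Reasoning
  m = sum D
  C = sum c
  T = ∑[ u < n ] (c u * D u)
  S = ∑[ u < n ] (D u * D u)
  ∑[c+D+1]*D : T + S + m ≡ n * m
  ∑[c+D+1]*D = begin-equality
    T + S + m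
      ≡⟨ cong (_+ m) (sym (∑-distrib-+ (λ u → c u * D u) (λ u → D u * D u))) ⟩
    ∑[ u < n ] (c u * D u + D u * D u) + m
      ≡⟨ sym (∑-distrib-+ (λ u → c u * D u + D u * D u) D) ⟩
    ∑[ u < n ] (c u * D u + D u * D u + D u)
      ≡⟨ sum-cong-≗ (λ u → trans (factor (c u) (D u)) (cong (_* D u) (c+D+1≡n u))) ⟩
    ∑[ u < n ] (n * D u)
      ≡⟨ sym (*-distribˡ-sum n D) ⟩
    n * m
      ∎
    where
    factor : ∀ a x → a * x + x * x + x ≡ (a + x + 1) * x
    factor = solve-∀
  ∑[c+D+1] : C + m + n ≡ n * n
  ∑[c+D+1] = begin-equality
    C + m + n
      ≡⟨ cong (C + m +_) (sym (trans (∑-const n 1) (*-identityʳ n))) ⟩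
    C + m + ∑[ u < n ] 1
      ≡⟨ cong (_+ ∑[ u < n ] 1) (sym (∑-distrib-+ c D)) ⟩
    ∑[ u < n ] (c u + D u) + ∑[ u < n ] 1
      ≡⟨ sym (∑-distrib-+ (λ u → c u + D u) (λ _ → 1)) ⟩
    ∑[ u < n ] (c u + D u + 1)
      ≡⟨ sum-cong-≗ c+D+1≡n ⟩
    ∑[ u < n ] n
      ≡⟨ ∑-const n n ⟩
    n * n
      ∎
  regroup₁ : ∀ n T S m → n * T + (n * S + n * m) ≡ n * (T + S + m)
  regroup₁ = solve-∀
  regroup₂ : ∀ n m → n * (n * m) ≡ m * (n * n)
  regroup₂ = solve-∀
  regroup₃ : ∀ m C n → m * (C + m + n) ≡ m * C + (m * m + n * m)
  regroup₃ = solve-∀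

𝟙 : Bool → ℕ
𝟙 true  = 1
𝟙 false = 0

𝟙-*-mono-≤ : ∀ {P : Set} (P? : Dec P) {x y} → (P → x ≤ y) →
  𝟙 (does P?) * x ≤ 𝟙 (does P?) * y
𝟙-*-mono-≤ (yes p) x≤y = *-monoʳ-≤ 1 (x≤y p)
𝟙-*-mono-≤ (no _)  _   = z≤n

𝟙-pos : ∀ {P : Set} (P? : Dec P) → P → 1 ≤ 𝟙 (does P?)
𝟙-pos P? p rewrite dec-true P? p = ≤-refl

module _ {A : Set} where

  length-filterᵇ-tabulate : ∀ {n} (q : A → Bool) (g : Fin n → A) →
    length (filterᵇ q (tabulate g)) ≡ ∑[ i < n ] 𝟙 (q (g i))
  length-filterᵇ-tabulate {zero}  q g = refl
  length-filterᵇ-tabulate {suc n} q g with q (g zero)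
  ... | true  = cong suc (length-filterᵇ-tabulate q (g ∘ suc))
  ... | false = length-filterᵇ-tabulate q (g ∘ suc)

  filterᵇ-filter : ∀ {P : A → Set} (q : A → Bool) (P? : Decidable P) xs →
    filterᵇ q (filter P? xs) ≡ filterᵇ (λ x → does (P? x) ∧ q x) xs
  filterᵇ-filter q P? [] = refl
  filterᵇ-filter q P? (x ∷ xs) with does (P? x)
  ... | false = filterᵇ-filter q P? xs
  ... | true with q x
  ...   | true  = cong (x ∷_) (filterᵇ-filter q P? xs)
  ...   | false = filterᵇ-filter q P? xs

  length-filterᵇ-concatMap : ∀ {B : Set} {n} (q : B → Bool) (f : A → List B) (g : Fin n → A) →
    length (filterᵇ q (concatMap f (tabulate g))) ≡ ∑[ i < n ] length (filterᵇ q (f (g i)))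
  length-filterᵇ-concatMap {n = zero}  q f g = refl
  length-filterᵇ-concatMap {n = suc n} q f g = begin
    length (filterᵇ q (f (g zero) ++ rest))
      ≡⟨ cong length (filter-++ (T? ∘ q) (f (g zero)) rest) ⟩
    length (filterᵇ q (f (g zero)) ++ filterᵇ q rest)
      ≡⟨ length-++ (filterᵇ q (f (g zero))) ⟩
    length (filterᵇ q (f (g zero))) + length (filterᵇ q rest)
      ≡⟨ cong (length (filterᵇ q (f (g zero))) +_) (length-filterᵇ-concatMap q f (g ∘ suc)) ⟩
    ∑[ i < suc n ] length (filterᵇ q (f (g i)))
      ∎
    where
    open ≡-Reasoning
    rest = concatMap f (tabulate (g ∘ suc))

∑-𝟙≟ : ∀ {n} (u : Fin n) → ∑[ v < n ] 𝟙 (does (u ≟ v)) ≡ 1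
∑-𝟙≟ {suc n} zero    = cong suc (trans (∑-const n 0) (*-zeroʳ n))
∑-𝟙≟ {suc n} (suc u) = ∑-𝟙≟ u

module _ {n} (G : Graph n) where

  nonAdj? : ∀ u v → Dec (NonAdj G u v)
  nonAdj? u v = ¬? (u ≟ v) ×-dec (adj G u v Bool.≟ false)

  nonAdj-sym : ∀ {u v} → NonAdj G u v → NonAdj G v u
  nonAdj-sym {u} {v} (u≢v , uv≡false) = u≢v ∘ sym , trans (Graph.sym G v u) uv≡false

  nonDeg : Fin n → ℕ
  nonDeg u = ∑[ v < n ] 𝟙 (does (nonAdj? u v))

  deg≡∑adj : ∀ u → deg G u ≡ ∑[ v < n ] 𝟙 (adj G u v)
  deg≡∑adj u = length-filterᵇ-tabulate (adj G u) id

  e≡∑∑adj< : e G ≡ ∑[ i < n ] ∑[ j < n ] 𝟙 (does (i <? j) ∧ adj G i j)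
  e≡∑∑adj< = begin
    e G
      ≡⟨ cong length (filterᵇ-filter adj′ (λ p → proj₁ p <? proj₂ p) (allPairs n)) ⟩
    length (filterᵇ adj< (allPairs n))
      ≡⟨ length-filterᵇ-concatMap adj< (λ i → map (i ,_) (allFin n)) id ⟩
    ∑[ i < n ] length (filterᵇ adj< (map (i ,_) (allFin n)))
      ≡⟨ sum-cong-≗ (λ i → trans (cong (length ∘ filterᵇ adj<) (map-tabulate id (i ,_)))
                                 (length-filterᵇ-tabulate adj< (i ,_))) ⟩
    ∑[ i < n ] ∑[ j < n ] 𝟙 (does (i <? j) ∧ adj G i j)
      ∎
    where
    open ≡-Reasoning
    adj′ adj< : Fin n × Fin n → Bool
    adj′ (i , j) = adj G i j
    adj< (i , j) = does (i <? j) ∧ adj G i j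

  𝟙adj-split : ∀ u v →
    𝟙 (adj G u v) ≡ 𝟙 (does (u <? v) ∧ adj G u v) + 𝟙 (does (v <? u) ∧ adj G v u)
  𝟙adj-split u v with <-cmp u v
  ... | tri< u<v _ v≮u rewrite dec-true (u <? v) u<v | dec-false (v <? u) v≮u =
    sym (+-identityʳ _)
  ... | tri≈ u≮u refl _ rewrite dec-false (u <? u) u≮u | Graph.irrefl G u = refl
  ... | tri> u≮v _ v<u rewrite dec-false (u <? v) u≮v | dec-true (v <? u) v<u =
    cong 𝟙 (Graph.sym G u v)

  ∑deg≡2*e : ∑[ u < n ] deg G u ≡ 2 * e G
  ∑deg≡2*e = begin
    ∑[ u < n ] deg G u
      ≡⟨ sum-cong-≗ (λ u → trans (deg≡∑adj u) (sum-cong-≗ (𝟙adj-split u))) ⟩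
    ∑[ u < n ] ∑[ v < n ] (a u v + a v u)
      ≡⟨ sum-cong-≗ (λ u → ∑-distrib-+ (a u) (λ v → a v u)) ⟩
    ∑[ u < n ] (∑[ v < n ] a u v + ∑[ v < n ] a v u)
      ≡⟨ ∑-distrib-+ (λ u → ∑[ v < n ] a u v) (λ u → ∑[ v < n ] a v u) ⟩
    E + ∑[ u < n ] ∑[ v < n ] a v u
      ≡⟨ cong (E +_) (∑-comm (λ u v → a v u)) ⟩
    E + E
      ≡⟨ cong (E +_) (sym (+-identityʳ E)) ⟩
    2 * E
      ≡⟨ cong (2 *_) (sym e≡∑∑adj<) ⟩
    2 * e G
      ∎
    where
    open ≡-Reasoning
    a : Fin n → Fin n → ℕ
    a i j = 𝟙 (does (i <? j) ∧ adj G i j)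
    E = ∑[ i < n ] ∑[ j < n ] a i j

  𝟙-partition : ∀ u v → 𝟙 (does (nonAdj? u v)) + 𝟙 (adj G u v) + 𝟙 (does (u ≟ v)) ≡ 1
  𝟙-partition u v with u ≟ v
  ... | yes refl rewrite Graph.irrefl G u = refl
  ... | no _ with adj G u v
  ...   | true  = refl
  ...   | false = refl

  nonDeg+deg+1≡n : ∀ u → nonDeg u + deg G u + 1 ≡ n
  nonDeg+deg+1≡n u = begin
    nonDeg u + deg G u + 1
      ≡⟨ cong₂ (λ x y → nonDeg u + x + y) (deg≡∑adj u) (sym (∑-𝟙≟ u)) ⟩
    nonDeg u + ∑[ v < n ] ad v + ∑[ v < n ] eq v
      ≡⟨ cong (_+ ∑[ v < n ] eq v) (sym (∑-distrib-+ na ad)) ⟩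
    ∑[ v < n ] (na v + ad v) + ∑[ v < n ] eq v
      ≡⟨ sym (∑-distrib-+ (λ v → na v + ad v) eq) ⟩
    ∑[ v < n ] (na v + ad v + eq v)
      ≡⟨ sum-cong-≗ (𝟙-partition u) ⟩
    ∑[ v < n ] 1
      ≡⟨ trans (∑-const n 1) (*-identityʳ n) ⟩
    n
      ∎
    where
    open ≡-Reasoning
    na ad eq : Fin n → ℕ
    na v = 𝟙 (does (nonAdj? u v))
    ad v = 𝟙 (adj G u v)
    eq v = 𝟙 (does (u ≟ v))

  nonAdj-𝟙-sym : ∀ u v → 𝟙 (does (nonAdj? u v)) ≡ 𝟙 (does (nonAdj? v u))
  nonAdj-𝟙-sym u v = cong 𝟙 (does-⇔ (mk⇔ nonAdj-sym nonAdj-sym) (nonAdj? u v) (nonAdj? v u))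

  ∑deg-lower-bound : ∀ p Q → ∃₂ (λ u v → NonAdj G u v) →
    (∀ u v → NonAdj G u v → 2 * p * n ≤ (deg G u + deg G v) * Q) →
    p * (n * n) ≤ ∑[ u < n ] deg G u * Q
  ∑deg-lower-bound p Q (u₀ , v₀ , u₀v₀) δ₂-bound =
    *-cancelʳ-≤ (p * (n * n)) (m * Q) C {{C≢0}} (begin
      p * (n * n) * C  ≡⟨ regroup₁ p n C ⟩
      n * (p * n * C)  ≤⟨ *-monoʳ-≤ n (*-cancelˡ-≤ 2 (≤-trans (≤-reflexive (regroup₂ p n C)) pairs)) ⟩
      n * (T * Q)      ≡⟨ sym (*-assoc n T Q) ⟩
      n * T * Q        ≤⟨ *-monoˡ-≤ Q (complement-∑-bound D nonDeg nonDeg+deg+1≡n) ⟩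
      m * C * Q        ≡⟨ regroup₃ m C Q ⟩
      m * Q * C        ∎)
    where
    open ≤-Reasoning
    D = deg G
    w : Fin n → Fin n → ℕ
    w u v = 𝟙 (does (nonAdj? u v))
    m = sum D
    C = sum nonDeg
    T = ∑[ u < n ] (nonDeg u * D u)
    K = 2 * p * n

    pairs : C * K ≤ 2 * (T * Q)
    pairs = begin
      C * K
        ≡⟨ ∑∑-*ʳ w K ⟩
      ∑[ u < n ] ∑[ v < n ] (w u v * K)
        ≤⟨ ∑-mono-≤ (λ u → ∑-mono-≤ (λ v → 𝟙-*-mono-≤ (nonAdj? u v) (δ₂-bound u v))) ⟩
      ∑[ u < n ] ∑[ v < n ] (w u v * ((D u + D v) * Q))
        ≡⟨ sum-cong-≗ (λ u → sum-cong-≗ (λ v → sym (*-assoc (w u v) (D u + D v) Q))) ⟩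
      ∑[ u < n ] ∑[ v < n ] (w u v * (D u + D v) * Q)
        ≡⟨ sym (∑∑-*ʳ (λ u v → w u v * (D u + D v)) Q) ⟩
      ∑[ u < n ] ∑[ v < n ] (w u v * (D u + D v)) * Q
        ≡⟨ cong (_* Q) (∑∑-sym-+ w D nonAdj-𝟙-sym) ⟩
      2 * T * Q
        ≡⟨ *-assoc 2 T Q ⟩
      2 * (T * Q)
        ∎

    C≢0 : NonZero C
    C≢0 = >-nonZero (begin
      1         ≤⟨ 𝟙-pos (nonAdj? u₀ v₀) u₀v₀ ⟩
      w u₀ v₀   ≤⟨ ≤-∑ (w u₀) v₀ ⟩
      nonDeg u₀ ≤⟨ ≤-∑ nonDeg u₀ ⟩
      C         ∎)

    regroup₁ : ∀ p n C → p * (n * n) * C ≡ n * (p * n * C)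
    regroup₁ = solve-∀
    regroup₂ : ∀ p n C → 2 * (p * n * C) ≡ C * (2 * p * n)
    regroup₂ = solve-∀
    regroup₃ : ∀ m C Q → m * C * Q ≡ m * Q * C
    regroup₃ = solve-∀

-- x = a / (1 + b), compared in ℚᵘ, where a product of fractions needs no gcd normalisation.
IsFraction : ℚ → ℕ → ℕ → Set
IsFraction x a b = toℚᵘ x ≃ mkℚᵘ (ℤ.+ a) b

ℕ→ℚ-fraction : ∀ k → IsFraction (ℕ→ℚ k) k 0
ℕ→ℚ-fraction k = toℚᵘ-cong (normalize-coprime (coprime-sym (1-coprimeTo k)))

*-fraction : ∀ {x y a b c e} → IsFraction x a b → IsFraction y c e →
  IsFraction (x *ℚ y) (a * c) (pred (suc b * suc e))
*-fraction {x} {y} {a} {b} {c} {e} x≃ y≃ =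
  ≃-trans (toℚᵘ-homo-* x y) (≃-trans (*-cong x≃ y≃)
    (ℚᵘ.*≡* (cong (ℤ._* ℤ.+ suc (pred (suc b * suc e))) (sym (pos-* a c)))))

fraction-cong : ∀ {a a′ b b′} → a ≡ a′ → b ≡ b′ → mkℚᵘ (ℤ.+ a) b ≃ mkℚᵘ (ℤ.+ a′) b′
fraction-cong refl refl = ≃-refl

ℕ*-fraction : ∀ {x a b} k → IsFraction x a b → IsFraction (ℕ→ℚ k *ℚ x) (k * a) b
ℕ*-fraction {b = b} k x≃ =
  ≃-trans (*-fraction (ℕ→ℚ-fraction k) x≃) (fraction-cong refl (cong pred (*-identityˡ (suc b))))

*ℕ-fraction : ∀ {x a b} k → IsFraction x a b → IsFraction (x *ℚ ℕ→ℚ k) (a * k) b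
*ℕ-fraction {b = b} k x≃ =
  ≃-trans (*-fraction x≃ (ℕ→ℚ-fraction k)) (fraction-cong refl (cong pred (*-identityʳ (suc b))))

*½-fraction : ∀ {x a b} → IsFraction x a b → IsFraction (x *ℚ ½) a (pred (2 * suc b))
*½-fraction {a = a} {b} x≃ =
  ≃-trans (*-fraction x≃ ≃-refl) (fraction-cong (*-identityʳ a) (cong pred (*-comm (suc b) 2)))

≤ℕ→ℚ⇔ : ∀ {x a b} c → IsFraction x a b → x ≤ℚ ℕ→ℚ c ⇔ a ≤ c * suc b
≤ℕ→ℚ⇔ {a = a} {b} c x≃ = mk⇔
  (λ x≤c → drop‿+≤+ (subst₂ ℤ._≤_ (ℤ.*-identityʳ (ℤ.+ a)) (sym (pos-* c (suc b)))
             (drop-*≤* (≤-respʳ-≃ c≃ (≤-respˡ-≃ x≃ (toℚᵘ-mono-≤ x≤c))))))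
  (λ a≤cb → toℚᵘ-cancel-≤ (≤-respˡ-≃ (≃-sym x≃) (≤-respʳ-≃ (≃-sym c≃)
             (*≤* (subst₂ ℤ._≤_ (sym (ℤ.*-identityʳ (ℤ.+ a))) (pos-* c (suc b)) (ℤ.+≤+ a≤cb))))))
  where
  c≃ = ℕ→ℚ-fraction c

fact3p5 : (d : ℚ) → 0ℚ < d → d < 1ℚ →
    (n : ℕ) → n ≥ 2 → (G : Graph n) →
    ∃₂ (λ u v → NonAdj G u v) →
    (∀ u v → NonAdj G u v → ℕ→ℚ 2 *ℚ d *ℚ ℕ→ℚ n ≤ℚ ℕ→ℚ (deg G u + deg G v)) →
    d *ℚ ℕ→ℚ (n * n) *ℚ ½ ≤ℚ ℕ→ℚ (e G)
fact3p5 (mkℚ ℤ.-[1+ _ ] _ _) (*<* ()) _ _ _ _ _ _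
fact3p5 d@(mkℚ (ℤ.+ p) q _) _ _ n _ G nonAdjacentPair δ₂≥2dn =
  Equivalence.from (≤ℕ→ℚ⇔ (e G) (*½-fraction (*ℕ-fraction (n * n) d-fraction)))
    (subst (p * (n * n) ≤_) (∑deg*Q≡e*2Q (suc q))
      (∑deg-lower-bound G p (suc q) nonAdjacentPair δ₂-bound))
  where
  d-fraction : IsFraction d p q
  d-fraction = ≃-refl

  δ₂-bound : ∀ u v → NonAdj G u v → 2 * p * n ≤ (deg G u + deg G v) * suc q
  δ₂-bound u v uv = Equivalence.to (≤ℕ→ℚ⇔ (deg G u + deg G v) 2dn-fraction) (δ₂≥2dn u v uv)
    where
    2dn-fraction : IsFraction (ℕ→ℚ 2 *ℚ d *ℚ ℕ→ℚ n) (2 * p * n) q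
    2dn-fraction = *ℕ-fraction n (ℕ*-fraction {x = d} 2 d-fraction)

  ∑deg*Q≡e*2Q : ∀ Q → ∑[ u < n ] deg G u * Q ≡ e G * (2 * Q)
  ∑deg*Q≡e*2Q Q = trans (cong (_* Q) (trans (∑deg≡2*e G) (*-comm 2 (e G)))) (*-assoc (e G) 2 Q)
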